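{- Let $h\ge 1$ be a fixed constant and let $G=(V,E)$ be an unweighted undirected $K_h$-minor-free graph of diameter at most $D$. Let $S=\{s_0,s_1,\ldots,s_{k-1}\}\subseteq V$ and for $v\in V$ let $\mathrm{Tuple}(v)=\langle d_G(v,s_0),\ldots,d_G(v,s_{k-1})\rangle$. Then the set $\mathrm{Tuple}(V)=\{\mathrm{Tuple}(v): v\in V\}$ satisfies $|\mathrm{Tuple}(V)|=O(|S|^{h-1}\cdot D^h)$.
   Context: $d_G$ is the shortest-path (hop) distance in $G$; the diameter is the maximum of $d_G(u,v)$ over all pairs of vertices. The constant in $O(\cdot)$ may depend on $h$. -}

module Defs where

open import Level using (0ℓ)
open import Data.Nat using (ℕ; zero; suc; _≤_)
open import Data.Nat.Properties using () renaming (_≟_ to _≟ℕ_)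
open import Data.Fin using (Fin)
open import Data.Fin.Properties using () renaming (_≟_ to _≟F_)
open import Data.Vec using (Vec; tabulate)
open import Data.Vec.Properties using (≡-dec)
open import Data.List using (List; length; map; deduplicate; allFin)
open import Data.Maybe using (Maybe; just)
open import Data.Product using (Σ; ∃; _×_; _,_)
open import Relation.Nullary using (¬_)
open import Relation.Binary.PropositionalEquality using (_≡_; _≢_)

record Graph (n : ℕ) : Set₁ where
  field
    Adj     : Fin n → Fin n → Set
    sym     : ∀ {u v} → Adj u v → Adj v u
    irrefl  : ∀ {u} → ¬ Adj u u
open Graph public

data Walk {n} (G : Graph n) : Fin n → Fin n → ℕ → Set where
  [] : ∀ {u} → Walk G u u zero
  _∷_ : ∀ {u w v ℓ} → Adj G u w → Walk G w v ℓ → Walk G u v (suc ℓ)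

data WalkIn {n} (G : Graph n) (P : Fin n → Set) : Fin n → Fin n → Set where
  [_] : ∀ {u} → P u → WalkIn G P u u
  cons : ∀ {u w v} → P u → Adj G u w → WalkIn G P w v → WalkIn G P u v

IsDist : ∀ {n} → Graph n → Fin n → Fin n → ℕ → Set
IsDist G u v d = Walk G u v d × (∀ ℓ → Walk G u v ℓ → d ≤ ℓ)

DiameterAtMost : ∀ {n} → Graph n → ℕ → Set
DiameterAtMost G D = ∀ u v → Σ ℕ λ ℓ → ℓ ≤ D × Walk G u v ℓ

-- A K_h-minor model: branch sets given by f v ≡ just i (hence disjoint),
-- each nonempty and connected, and every two distinct branch sets joined by an edge.
record KMinorModel {n} (h : ℕ) (G : Graph n) : Set where
  field
    branch    : Fin n → Maybe (Fin h)
    nonempty  : ∀ i → ∃ λ v → branch v ≡ just i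
    connected : ∀ i u v → branch u ≡ just i → branch v ≡ just i →
                WalkIn G (λ x → branch x ≡ just i) u v
    adjacent  : ∀ i j → i ≢ j → ∃ λ u → ∃ λ v →
                branch u ≡ just i × branch v ≡ just j × Adj G u v

KMinorFree : ∀ {n} → ℕ → Graph n → Set
KMinorFree h G = ¬ KMinorModel h G

Tuple : ∀ {n k} → (Fin n → Fin n → ℕ) → (Fin k → Fin n) → Fin n → Vec ℕ k
Tuple dist s v = tabulate (λ i → dist v (s i))

numTuples : ∀ {n k} → (Fin n → Fin n → ℕ) → (Fin k → Fin n) → ℕ
numTuples {n} dist s = length (deduplicate (≡-dec _≟ℕ_) (map (Tuple dist s) (allFin n)))

module Submission where

-- Every entry of a tuple is at most D, so Tuple(v) is determined by which of the k·D balls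
-- B(s_i, r), r < D, contain v.  These balls have VC dimension below h: if V shattered h of them,
-- letting every vertex join the ball it lies deepest inside would give h connected, pairwise
-- adjacent branch sets, i.e. a K_h minor.  By the Sauer–Shelah lemma the number of traces is
-- then at most Σ_{i<h} (kD choose i) ≤ (1 + kD)^{h−1} = O(k^{h−1} D^h).

open import Defs hiding (sym)
open import Data.Bool using (Bool; true; false; T; _∨_)
open import Data.Bool.Properties using (∨-zeroʳ) renaming (_≟_ to _≟ᵇ_)
open import Data.Fin using (Fin; toℕ; fromℕ<; combine; remQuot) renaming (zero to fzero)
open import Data.Fin.Properties using (toℕ-injective; toℕ<n; toℕ-fromℕ<; remQuot-combine)
  renaming (_≟_ to _≟ᶠ_)
open import Data.Fin.Subset using (Subset; ∣_∣; ⊥)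
open import Data.Fin.Subset.Properties using (∣⊥∣≡0)
open import Data.List using (List; []; _∷_; length; filter; _++_; deduplicate; allFin)
import Data.List as List
open import Data.List.Extrema.Nat using (argmin; f[argmin]≤f[xs]; max; xs≤max)
open import Data.List.Membership.Propositional using (_∈_)
open import Data.List.Membership.Propositional.Properties
  using (∈-++⁻; ∈-filter⁻; ∈-allFin; ∈-map⁺; ∈-map⁻; ∈-deduplicate⁻)
open import Data.List.Properties using (length-++; length-map)
open import Data.List.Relation.Unary.All as All using ([]; _∷_)
open import Data.List.Relation.Unary.AllPairs using ([]; _∷_)
open import Data.List.Relation.Unary.Any using (here; there)
open import Data.List.Relation.Unary.Unique.Propositional using (Unique)
import Data.List.Relation.Unary.Unique.Propositional.Properties as Unique
open import Data.List.Relation.Unary.Unique.DecPropositional.Properties using (deduplicate-!)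
open import Data.Maybe using (just; nothing)
open import Data.Maybe.Properties using (just-injective)
open import Data.Nat using (ℕ; zero; suc; _+_; _*_; _^_; _∸_; _≤_; _<_; z≤n; s≤s; s≤s⁻¹; _≤ᵇ_)
open import Data.Nat.DivMod using (_%_; [m+kn]%n≡m%n; m<n⇒m%n≡m)
open import Data.Nat.Properties
open import Algebra.Properties.CommutativeSemigroup *-commutativeSemigroup using (interchange)
open import Data.Product using (Σ; ∃-syntax; _×_; _,_; proj₁; proj₂)
open import Data.Sum using (_⊎_; inj₁; inj₂; [_,_]′)
open import Data.Unit using (tt)
open import Data.Vec using (Vec; []; _∷_; map; lookup; tabulate)
open import Data.Vec.Properties using (lookup-map; lookup∘tabulate; map-cong; tabulate-cong)
import Data.Vec.Properties as Vec
open import Function using (_∘_)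
open import Function.Definitions using (Injective)
open import Relation.Nullary using (¬_; yes; no; does; contradiction)
open import Relation.Nullary.Decidable using (dec-true; dec-false; ¬?)
open import Relation.Unary using (Decidable)
open import Relation.Binary.PropositionalEquality

≤ᵇ≡true⇒≤ : ∀ {m n} → (m ≤ᵇ n) ≡ true → m ≤ n
≤ᵇ≡true⇒≤ {m} {n} eq = ≤ᵇ⇒≤ m n (subst T (sym eq) tt)

≤ᵇ≡false⇒> : ∀ {m n} → (m ≤ᵇ n) ≡ false → n < m
≤ᵇ≡false⇒> eq = ≰⇒> (λ m≤n → subst T eq (≤⇒≤ᵇ m≤n))

^-distribʳ-* : ∀ a b e → (a * b) ^ e ≡ a ^ e * b ^ e
^-distribʳ-* a b zero    = refl
^-distribʳ-* a b (suc e) =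
  trans (cong (a * b *_) (^-distribʳ-* a b e)) (interchange a b (a ^ e) (b ^ e))

length-filter+filter∁ : ∀ {A : Set} {P : A → Set} (P? : Decidable P) xs →
  length (filter P? xs) + length (filter (¬? ∘ P?) xs) ≡ length xs
length-filter+filter∁ P? []       = refl
length-filter+filter∁ P? (x ∷ xs) with does (P? x)
... | true  = cong suc (length-filter+filter∁ P? xs)
... | false = trans (+-suc _ _) (cong suc (length-filter+filter∁ P? xs))

Unique-map⁺ : ∀ {A B : Set} {f : A → B} {xs : List A} →
  (∀ {x y} → x ∈ xs → y ∈ xs → f x ≡ f y → x ≡ y) → Unique xs → Unique (List.map f xs)
Unique-map⁺ {xs = []} _ [] = []
Unique-map⁺ {f = f} {xs = x ∷ xs} inj (x∉xs ∷ xs!) =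
  All.tabulate (λ fy∈ fx≡fy → let y , y∈xs , fy≡ = ∈-map⁻ f fy∈ in
    All.lookup x∉xs y∈xs (inj (here refl) (there y∈xs) (trans fx≡fy fy≡)))
  ∷ Unique-map⁺ (λ x∈ y∈ → inj (there x∈) (there y∈)) xs!

-- Sauer–Shelah lemma

restrict : ∀ {N} {A : Set} (m : Subset N) → Vec A N → Vec A ∣ m ∣
restrict []          []       = []
restrict (true ∷ m)  (x ∷ xs) = x ∷ restrict m xs
restrict (false ∷ m) (_ ∷ xs) = restrict m xs

restrict-map : ∀ {N} {A B : Set} (f : A → B) (m : Subset N) xs →
  restrict m (map f xs) ≡ map f (restrict m xs)
restrict-map f []          []       = refl
restrict-map f (true ∷ m)  (x ∷ xs) = cong (f x ∷_) (restrict-map f m xs)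
restrict-map f (false ∷ m) (_ ∷ xs) = restrict-map f m xs

restrict-⊥ : ∀ {N} {A : Set} (xs : Vec A N) (ys : Vec A ∣ ⊥ {N} ∣) → restrict ⊥ xs ≡ ys
restrict-⊥ []       [] = refl
restrict-⊥ (_ ∷ xs) ys = restrict-⊥ xs ys

Shatters : ∀ {N} → List (Subset N) → Subset N → Set
Shatters F m = ∀ p → ∃[ x ] x ∈ F × restrict m x ≡ p

ShattersNoSetOfSize : ∀ {N} → ℕ → List (Subset N) → Set
ShattersNoSetOfSize e F = ∀ m → ∣ m ∣ ≡ e → ¬ Shatters F m

shatters-⊥ : ∀ {N} {F : List (Subset N)} {x} → x ∈ F → Shatters F ⊥
shatters-⊥ {x = x} x∈F p = x , x∈F , restrict-⊥ x p

shatters-outside : ∀ {N} {F : List (Subset (suc N))} {U m} →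
  (∀ {x} → x ∈ U → ∃[ b ] (b ∷ x) ∈ F) → Shatters U m → Shatters F (false ∷ m)
shatters-outside U⊆F sh p =
  let x , x∈U , x↾m≡p = sh p ; b , bx∈F = U⊆F x∈U in b ∷ x , bx∈F , x↾m≡p

shatters-inside : ∀ {N} {F : List (Subset (suc N))} {I m} →
  (∀ {x} → x ∈ I → (false ∷ x) ∈ F × (true ∷ x) ∈ F) → Shatters I m → Shatters F (true ∷ m)
shatters-inside {F = F} I⊆F sh (b ∷ p) =
  let x , x∈I , x↾m≡p = sh p in b ∷ x , choose b (I⊆F x∈I) , cong (b ∷_) x↾m≡p
  where
  choose : ∀ {x} b → (false ∷ x) ∈ F × (true ∷ x) ∈ F → (b ∷ x) ∈ F
  choose false = proj₁
  choose true  = proj₂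

slice : ∀ {N} → Bool → List (Subset (suc N)) → List (Subset N)
slice b []            = []
slice b ((c ∷ x) ∷ F) with b ≟ᵇ c
... | yes _ = x ∷ slice b F
... | no  _ = slice b F

∈-slice⁻ : ∀ {N} b (F : List (Subset (suc N))) {x} → x ∈ slice b F → (b ∷ x) ∈ F
∈-slice⁻ b ((c ∷ y) ∷ F) x∈ with b ≟ᵇ c | x∈
... | yes refl | here refl = here refl
... | yes refl | there x∈′ = there (∈-slice⁻ b F x∈′)
... | no _     | x∈′       = there (∈-slice⁻ b F x∈′)

slice-unique : ∀ {N} b {F : List (Subset (suc N))} → Unique F → Unique (slice b F)
slice-unique b {[]}          []         = []
slice-unique b {(c ∷ y) ∷ F} (y∉F ∷ F!) with b ≟ᵇ c
... | yes refl = All.tabulate (λ x∈ y≡x → All.lookup y∉F (∈-slice⁻ b F x∈) (cong (b ∷_) y≡x))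
               ∷ slice-unique b F!
... | no _     = slice-unique b F!

length-slices : ∀ {N} (F : List (Subset (suc N))) →
  length F ≡ length (slice false F) + length (slice true F)
length-slices []                = refl
length-slices ((false ∷ _) ∷ F) = cong suc (length-slices F)
length-slices ((true ∷ _) ∷ F)  = trans (cong suc (length-slices F)) (sym (+-suc _ _))

-- Φ N e = Σ_{i<e} (N choose i), by Pascal's rule.
Φ : ℕ → ℕ → ℕ
Φ N       zero    = 0
Φ zero    (suc e) = 1
Φ (suc N) (suc e) = Φ N (suc e) + Φ N e

Φ≤[1+N]^e : ∀ N e → Φ N (suc e) ≤ suc N ^ e
Φ≤[1+N]^e zero    e       = ≤-reflexive (sym (^-zeroˡ e))
Φ≤[1+N]^e (suc N) zero    = ≤-trans (≤-reflexive (+-identityʳ _)) (Φ≤[1+N]^e N zero)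
Φ≤[1+N]^e (suc N) (suc e) = begin
  Φ N (suc (suc e)) + Φ N (suc e)   ≤⟨ +-mono-≤ (Φ≤[1+N]^e N (suc e)) (Φ≤[1+N]^e N e) ⟩
  suc N * suc N ^ e + suc N ^ e     ≡⟨ +-comm (suc N * suc N ^ e) _ ⟩
  suc (suc N) * suc N ^ e           ≤⟨ *-monoʳ-≤ (suc (suc N)) (^-monoˡ-≤ e (n≤1+n (suc N))) ⟩
  suc (suc N) ^ suc e               ∎
  where open ≤-Reasoning

sauer-shelah : ∀ N e {F : List (Subset N)} → Unique F → ShattersNoSetOfSize e F → length F ≤ Φ N e
sauer-shelah N       zero    {[]}    _ _ = z≤n
sauer-shelah N       zero    {x ∷ F} _ none = contradiction (shatters-⊥ (here refl)) (none ⊥ (∣⊥∣≡0 N))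
sauer-shelah zero    (suc e) {[]}             _ _ = z≤n
sauer-shelah zero    (suc e) {[] ∷ []}        _ _ = ≤-refl
sauer-shelah zero    (suc e) {[] ∷ [] ∷ _} ((≢ ∷ _) ∷ _) _ = contradiction refl ≢
-- |F| = |A ∪ B| + |A ∩ B| for the slices A, B of F; the union shatters no set of size e + 1
-- and the intersection none of size e, else F would shatter one of size e + 1.
sauer-shelah (suc N) (suc e) {F} F! none = begin
  length F                           ≡⟨ length-slices F ⟩
  length A + length B                ≡⟨ cong (length A +_) (length-filter+filter∁ (_∈? A) B) ⟨
  length A + (length I + length B∖A) ≡⟨ cong (length A +_) (+-comm (length I) _) ⟩
  length A + (length B∖A + length I) ≡⟨ +-assoc (length A) _ _ ⟨
  length A + length B∖A + length I   ≡⟨ cong (_+ length I) (length-++ A) ⟨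
  length U + length I                ≤⟨ +-mono-≤ (sauer-shelah N (suc e) U! U-none) (sauer-shelah N e I! I-none) ⟩
  Φ N (suc e) + Φ N e                ∎
  where
  open ≤-Reasoning
  open import Data.List.Membership.DecPropositional (Vec.≡-dec _≟ᵇ_) using (_∈?_; _∉?_)
  A B I B∖A U : List (Subset N)
  A   = slice false F
  B   = slice true F
  I   = filter (_∈? A) B
  B∖A = filter (_∉? A) B
  U   = A ++ B∖A

  U⊆F : ∀ {x} → x ∈ U → ∃[ b ] (b ∷ x) ∈ F
  U⊆F x∈U with ∈-++⁻ A x∈U
  ... | inj₁ x∈A   = false , ∈-slice⁻ false F x∈A
  ... | inj₂ x∈B∖A = true , ∈-slice⁻ true F (proj₁ (∈-filter⁻ (_∉? A) x∈B∖A))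

  I⊆F : ∀ {x} → x ∈ I → (false ∷ x) ∈ F × (true ∷ x) ∈ F
  I⊆F x∈I = let x∈B , x∈A = ∈-filter⁻ (_∈? A) x∈I in ∈-slice⁻ false F x∈A , ∈-slice⁻ true F x∈B

  U! : Unique U
  U! = Unique.++⁺ (slice-unique false F!) (Unique.filter⁺ (_∉? A) (slice-unique true F!))
         (λ (x∈A , x∈B∖A) → proj₂ (∈-filter⁻ (_∉? A) {xs = B} x∈B∖A) x∈A)

  I! : Unique I
  I! = Unique.filter⁺ (_∈? A) (slice-unique true F!)

  U-none : ShattersNoSetOfSize (suc e) U
  U-none m ∣m∣≡ sh = none (false ∷ m) ∣m∣≡ (shatters-outside U⊆F sh)

  I-none : ShattersNoSetOfSize e I
  I-none m ∣m∣≡ sh = none (true ∷ m) (cong suc ∣m∣≡) (shatters-inside I⊆F sh)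

module _ {n} {G : Graph n} {P : Fin n → Set} where

  WalkIn-source : ∀ {u v} → WalkIn G P u v → P u
  WalkIn-source [ pu ]        = pu
  WalkIn-source (cons pu _ _) = pu

  WalkIn-target : ∀ {u v} → WalkIn G P u v → P v
  WalkIn-target [ pv ]       = pv
  WalkIn-target (cons _ _ w) = WalkIn-target w

  WalkIn-++ : ∀ {u v w} → WalkIn G P u v → WalkIn G P v w → WalkIn G P u w
  WalkIn-++ [ _ ]         w′ = w′
  WalkIn-++ (cons pu e w) w′ = cons pu e (WalkIn-++ w w′)

  WalkIn-reverse : ∀ {u v} → WalkIn G P u v → WalkIn G P v u
  WalkIn-reverse [ pu ]        = [ pu ]
  WalkIn-reverse (cons pu e w) =
    WalkIn-++ (WalkIn-reverse w) (cons (WalkIn-source w) (Graph.sym G e) [ pu ])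

-- Geodesics and balls

module Geodesics {n} (G : Graph n) {dist : Fin n → Fin n → ℕ}
                 (isDist : ∀ u v → IsDist G u v (dist u v)) where

  dist-minimal : ∀ {u v ℓ} → Walk G u v ℓ → dist u v ≤ ℓ
  dist-minimal {u} {v} {ℓ} w = proj₂ (isDist u v) ℓ w

  dist-adj : ∀ {x y} t → Adj G x y → dist x t ≤ suc (dist y t)
  dist-adj t e = dist-minimal (e ∷ proj₁ (isDist _ t))

  dist≡0⇒≡ : ∀ {x t} → dist x t ≡ 0 → x ≡ t
  dist≡0⇒≡ {x} {t} d = walk₀ (subst (Walk G x t) d (proj₁ (isDist x t)))
    where
    walk₀ : ∀ {u v} → Walk G u v 0 → u ≡ v
    walk₀ [] = refl

  NextToward : Fin n → Fin n → Fin n → Set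
  NextToward t x y = Adj G x y × dist x t ≡ suc (dist y t)

  dist-next : ∀ {x t m} → dist x t ≡ suc m → ∃[ y ] NextToward t x y × dist y t ≡ m
  dist-next {x} {t} {m} d with subst (Walk G x t) d (proj₁ (isDist x t))
  ... | _∷_ {w = y} e rest = y , (e , trans d (cong suc (sym dy))) , dy
    where
    dy : dist y t ≡ m
    dy = ≤-antisym (dist-minimal rest) (s≤s⁻¹ (subst (_≤ suc (dist y t)) d (dist-adj t e)))

  BallsShattered : ∀ {H} → (Fin H → Fin n) → (Fin H → ℕ) → Set
  BallsShattered {H} center radius =
    (P : Fin H → Bool) → ∃[ v ] ∀ j → (dist v (center j) ≤ᵇ radius j) ≡ P j

  -- x joins the ball it lies deepest inside, i.e. minimises d(x, c_j) − r_j; this is shifted by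
  -- R to stay in ℕ, and ties are broken by the index j.
  module Cells {H′} (center : Fin (suc H′) → Fin n) (radius : Fin (suc H′) → ℕ) where

    H : ℕ
    H = suc H′

    R : ℕ
    R = max 0 (List.map radius (allFin H))

    radius≤R : ∀ j → radius j ≤ R
    radius≤R j = All.lookup (xs≤max 0 _) (∈-map⁺ radius (∈-allFin j))

    key : Fin H → Fin n → ℕ
    key j x = dist x (center j) + (R ∸ radius j)

    weight : Fin H → Fin n → ℕ
    weight j x = toℕ j + key j x * H

    weight-injective : ∀ {a b} x → weight a x ≡ weight b x → a ≡ b
    weight-injective {a} {b} x eq = toℕ-injective (begin
      toℕ a          ≡⟨ weight%H a ⟨
      weight a x % H ≡⟨ cong (_% H) eq ⟩
      weight b x % H ≡⟨ weight%H b ⟩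
      toℕ b          ∎)
      where
      open ≡-Reasoning
      weight%H : ∀ j → weight j x % H ≡ toℕ j
      weight%H j = trans ([m+kn]%n≡m%n (toℕ j) (key j x) H) (m<n⇒m%n≡m (toℕ<n j))

    weight-< : ∀ {a z x} → key a x < key z x → weight a x < weight z x
    weight-< {a} {z} {x} lt = begin-strict
      weight a x          <⟨ +-monoˡ-< (key a x * H) (toℕ<n a) ⟩
      suc (key a x) * H   ≤⟨ *-monoˡ-≤ H lt ⟩
      key z x * H         ≤⟨ m≤n+m (key z x * H) (toℕ z) ⟩
      weight z x          ∎
      where open ≤-Reasoning

    +-suc-*H : ∀ i k → i + suc k * H ≡ i + k * H + H
    +-suc-*H i k = trans (cong (i +_) (+-comm H (k * H))) (sym (+-assoc i (k * H) H))

    weight-adj : ∀ z {x y} → Adj G x y → weight z x ≤ weight z y + H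
    weight-adj z {x} {y} e = ≤-trans
      (+-monoʳ-≤ (toℕ z) (*-monoˡ-≤ H (+-monoˡ-≤ (R ∸ radius z) (dist-adj (center z) e))))
      (≤-reflexive (+-suc-*H (toℕ z) (key z y)))

    weight-next : ∀ {b x y} → NextToward (center b) x y → weight b x ≡ weight b y + H
    weight-next {b} {x} {y} (_ , d) =
      trans (cong (λ k → toℕ b + (k + (R ∸ radius b)) * H) d) (+-suc-*H (toℕ b) (key b y))

    -- One step toward c_b lowers b's weight by exactly H and any other weight by at most H.
    lead-step : ∀ {b z x y} → NextToward (center b) x y → weight b x ≤ weight z x → weight b y ≤ weight z y
    lead-step {b} {z} {x} {y} next le = +-cancelʳ-≤ H _ _ (begin
      weight b y + H ≡⟨ weight-next next ⟨
      weight b x     ≤⟨ le ⟩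
      weight z x     ≤⟨ weight-adj z (proj₁ next) ⟩
      weight z y + H ∎)
      where open ≤-Reasoning

    lead-step< : ∀ {b z x y} → NextToward (center b) x y → weight b x < weight z x → weight b y < weight z y
    lead-step< {b} {z} {x} {y} next lt = +-cancelʳ-< H _ _ (begin-strict
      weight b y + H ≡⟨ weight-next next ⟨
      weight b x     <⟨ lt ⟩
      weight z x     ≤⟨ weight-adj z (proj₁ next) ⟩
      weight z y + H ∎)
      where open ≤-Reasoning

    opaque
      owner : Fin n → Fin H
      owner x = argmin (λ j → weight j x) fzero (allFin H)

      owner-minimal : ∀ x z → weight (owner x) x ≤ weight z x
      owner-minimal x z = All.lookup {P = λ j → weight (owner x) x ≤ weight j x}
        (f[argmin]≤f[xs] {f = λ j → weight j x} fzero (allFin H)) (∈-allFin z)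

    Owns : Fin H → Fin n → Set
    Owns a x = just (owner x) ≡ just a

    minimal⇒owns : ∀ {a x} → (∀ z → weight a x ≤ weight z x) → Owns a x
    minimal⇒owns {a} {x} min =
      cong just (weight-injective x (≤-antisym (owner-minimal x a) (min (owner x))))

    owns⇒minimal : ∀ {a x} → Owns a x → ∀ z → weight a x ≤ weight z x
    owns⇒minimal {x = x} refl = owner-minimal x

    owns-next : ∀ {a x y} → NextToward (center a) x y → Owns a x → Owns a y
    owns-next next ox = minimal⇒owns (λ z → lead-step next (owns⇒minimal ox z))

    descend : ∀ {a x} m → dist x (center a) ≡ m → Owns a x → WalkIn G (Owns a) x (center a)
    descend zero d ox with refl ← dist≡0⇒≡ d = [ ox ]
    descend (suc m) d ox with y , next , dy ← dist-next d =
      cons ox (proj₁ next) (descend m dy (owns-next next ox))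

    owned-connected : ∀ {a u v} → Owns a u → Owns a v → WalkIn G (Owns a) u v
    owned-connected ou ov = WalkIn-++ (descend _ refl ou) (WalkIn-reverse (descend _ refl ov))

    inside⇒key≤R : ∀ {v j} → (dist v (center j) ≤ᵇ radius j) ≡ true → key j v ≤ R
    inside⇒key≤R {v} {j} inside = begin
      dist v (center j) + (R ∸ radius j) ≤⟨ +-monoˡ-≤ (R ∸ radius j) (≤ᵇ≡true⇒≤ inside) ⟩
      radius j + (R ∸ radius j)          ≡⟨ m+[n∸m]≡n (radius≤R j) ⟩
      R                                  ∎
      where open ≤-Reasoning

    outside⇒R<key : ∀ {v j} → (dist v (center j) ≤ᵇ radius j) ≡ false → R < key j v
    outside⇒R<key {v} {j} outside = begin-strict
      R                                  ≡⟨ m+[n∸m]≡n (radius≤R j) ⟨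
      radius j + (R ∸ radius j)          <⟨ +-monoˡ-< (R ∸ radius j) (≤ᵇ≡false⇒> outside) ⟩
      dist v (center j) + (R ∸ radius j) ∎
      where open ≤-Reasoning

    inside-outside⇒< : ∀ {v b z} → (dist v (center b) ≤ᵇ radius b) ≡ true →
      (dist v (center z) ≤ᵇ radius z) ≡ false → weight b v < weight z v
    inside-outside⇒< inside outside = weight-< (≤-<-trans (inside⇒key≤R inside) (outside⇒R<key outside))

    OnlyRival : Fin H → Fin H → Fin n → Set
    OnlyRival a b y = ∀ z → z ≢ a → z ≢ b → weight b y < weight z y

    owner-rival : ∀ {a b y} → OnlyRival a b y → owner y ≡ a ⊎ owner y ≡ b
    owner-rival {a} {b} {y} rival with owner y ≟ᶠ a | owner y ≟ᶠ b
    ... | yes o≡a | _       = inj₁ o≡a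
    ... | no _    | yes o≡b = inj₂ o≡b
    ... | no o≢a  | no o≢b  = contradiction (owner-minimal y b) (<⇒≱ (rival (owner y) o≢a o≢b))

    rival-next : ∀ {a b x y} → NextToward (center b) x y → OnlyRival a b x → OnlyRival a b y
    rival-next next rival z z≢a z≢b = lead-step< next (rival z z≢a z≢b)

    Joined : Fin H → Fin H → Set
    Joined a b = ∃[ u ] ∃[ v ] Owns a u × Owns b v × Adj G u v

    joined-sym : ∀ {a b} → Joined a b → Joined b a
    joined-sym (u , v , ou , ov , e) = v , u , ov , ou , Graph.sym G e

    module _ (shattered : BallsShattered center radius) where

      loner : Fin H → Fin n
      loner a = proj₁ (shattered (λ j → does (j ≟ᶠ a)))

      loner-owned : ∀ a → Owns a (loner a)
      loner-owned a = minimal⇒owns a-minimal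
        where
        realised : ∀ j → (dist (loner a) (center j) ≤ᵇ radius j) ≡ does (j ≟ᶠ a)
        realised = proj₂ (shattered (λ j → does (j ≟ᶠ a)))
        a-minimal : ∀ z → weight a (loner a) ≤ weight z (loner a)
        a-minimal z with z ≟ᶠ a
        ... | yes refl = ≤-refl
        ... | no z≢a   = <⇒≤ (inside-outside⇒< (trans (realised a) (dec-true (a ≟ᶠ a) refl))
                                              (trans (realised z) (dec-false (z ≟ᶠ a) z≢a)))

      center-owned : ∀ a → Owns a (center a)
      center-owned a = WalkIn-target (descend _ refl (loner-owned a))

      -- Walking from an a-owned vertex toward c_b, the owner stays in {a, b} and ends as b.
      cross : ∀ {a b y} m → a ≢ b → dist y (center b) ≡ m → OnlyRival a b y → Owns a y → Joined a b
      cross zero a≢b d _ oy with refl ← dist≡0⇒≡ d =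
        contradiction (just-injective (trans (sym oy) (center-owned _))) a≢b
      cross {y = y} (suc m) a≢b d rival oy with y′ , next , dy′ ← dist-next d
        with owner-rival (rival-next next rival)
      ... | inj₁ o≡a = cross m a≢b dy′ (rival-next next rival) (cong just o≡a)
      ... | inj₂ o≡b = y , y′ , oy , cong just o≡b , proj₁ next

      adjacent : ∀ a b → a ≢ b → Joined a b
      adjacent a b a≢b =
        [ (λ o≡a → cross _ a≢b refl rival-b (cong just o≡a))
        , (λ o≡b → joined-sym (cross _ (a≢b ∘ sym) refl rival-a (cong just o≡b)))
        ]′ (owner-rival rival-b)
        where
        pair : Fin H → Bool
        pair j = does (j ≟ᶠ a) ∨ does (j ≟ᶠ b)
        c : Fin n
        c = proj₁ (shattered pair)
        realised : ∀ j → (dist c (center j) ≤ᵇ radius j) ≡ pair j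
        realised = proj₂ (shattered pair)
        inside-a : (dist c (center a) ≤ᵇ radius a) ≡ true
        inside-a = trans (realised a) (cong (_∨ does (a ≟ᶠ b)) (dec-true (a ≟ᶠ a) refl))
        inside-b : (dist c (center b) ≤ᵇ radius b) ≡ true
        inside-b = trans (realised b) (trans (cong (does (b ≟ᶠ a) ∨_) (dec-true (b ≟ᶠ b) refl)) (∨-zeroʳ _))
        outside : ∀ z → z ≢ a → z ≢ b → (dist c (center z) ≤ᵇ radius z) ≡ false
        outside z z≢a z≢b = trans (realised z) (cong₂ _∨_ (dec-false (z ≟ᶠ a) z≢a) (dec-false (z ≟ᶠ b) z≢b))
        rival-b : OnlyRival a b c
        rival-b z z≢a z≢b = inside-outside⇒< inside-b (outside z z≢a z≢b)
        rival-a : OnlyRival b a c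
        rival-a z z≢b z≢a = inside-outside⇒< inside-a (outside z z≢a z≢b)

      model : KMinorModel H G
      model = record
        { branch    = λ x → just (owner x)
        ; nonempty  = λ a → loner a , loner-owned a
        ; connected = λ a u v → owned-connected
        ; adjacent  = adjacent
        }

  ballsShattered⇒KMinorModel : ∀ {H} {center : Fin H → Fin n} {radius : Fin H → ℕ} →
    BallsShattered center radius → KMinorModel H G
  ballsShattered⇒KMinorModel {zero} _ =
    record { branch = λ _ → nothing ; nonempty = λ () ; connected = λ () ; adjacent = λ () }
  ballsShattered⇒KMinorModel {suc _} = Cells.model _ _

-- Distance tuples as traces of balls

module TupleFamily {n} {G : Graph n} {D} (diam : DiameterAtMost G D)
                   {dist : Fin n → Fin n → ℕ} (isDist : ∀ u v → IsDist G u v (dist u v))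
                   {k} (s : Fin k → Fin n) where

  open Geodesics G isDist

  dist≤D : ∀ u v → dist u v ≤ D
  dist≤D u v = let _ , ℓ≤D , w = diam u v in ≤-trans (dist-minimal w) ℓ≤D

  tests : Vec (Fin k × Fin D) (k * D)
  tests = tabulate (remQuot D)

  passes : Fin n → Fin k × Fin D → Bool
  passes v (i , r) = dist v (s i) ≤ᵇ toℕ r

  ballVector : Fin n → Subset (k * D)
  ballVector v = map (passes v) tests

  encode : Vec ℕ k → Subset (k * D)
  encode t = map (λ (i , r) → lookup t i ≤ᵇ toℕ r) tests

  encode-Tuple : ∀ v → encode (Tuple dist s v) ≡ ballVector v
  encode-Tuple v = map-cong (λ (i , r) → cong (_≤ᵇ toℕ r) (lookup∘tabulate _ i)) tests

  lookup-ballVector : ∀ v i r → lookup (ballVector v) (combine i r) ≡ passes v (i , r)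
  lookup-ballVector v i r = trans (lookup-map (combine i r) (passes v) tests)
    (cong (passes v) (trans (lookup∘tabulate (remQuot D) (combine i r)) (remQuot-combine i r)))

  -- If d(w, s_i) < D, the test "d(·, s_i) ≤ d(w, s_i)" is passed by w, hence by v.
  ballVector-≤ : ∀ {v w} → ballVector v ≡ ballVector w → ∀ i → dist v (s i) ≤ dist w (s i)
  ballVector-≤ {v} {w} same i with dist w (s i) <? D
  ... | no ≮D = ≤-trans (dist≤D v (s i)) (≮⇒≥ ≮D)
  ... | yes <D = subst (dist v (s i) ≤_) (toℕ-fromℕ< <D) (≤ᵇ⇒≤ _ _ (subst T (sym same-test) w-passes))
    where
    r = fromℕ< <D
    same-test : passes v (i , r) ≡ passes w (i , r)
    same-test = trans (sym (lookup-ballVector v i r))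
      (trans (cong (λ x → lookup x (combine i r)) same) (lookup-ballVector w i r))
    w-passes : T (passes w (i , r))
    w-passes = ≤⇒≤ᵇ (≤-reflexive (sym (toℕ-fromℕ< <D)))

  ballVector-determines-Tuple : ∀ {v w} → ballVector v ≡ ballVector w → Tuple dist s v ≡ Tuple dist s w
  ballVector-determines-Tuple same =
    tabulate-cong (λ i → ≤-antisym (ballVector-≤ same i) (ballVector-≤ (sym same) i))

  tuples : List (Vec ℕ k)
  tuples = deduplicate (Vec.≡-dec _≟_) (List.map (Tuple dist s) (allFin n))

  ∈-tuples⁻ : ∀ {t} → t ∈ tuples → ∃[ v ] t ≡ Tuple dist s v
  ∈-tuples⁻ t∈ = let v , _ , t≡ = ∈-map⁻ (Tuple dist s) (∈-deduplicate⁻ _ _ t∈) in v , t≡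

  family : List (Subset (k * D))
  family = List.map encode tuples

  ∈-family⁻ : ∀ {x} → x ∈ family → ∃[ v ] x ≡ ballVector v
  ∈-family⁻ x∈ =
    let t , t∈ , x≡ = ∈-map⁻ encode x∈ ; v , t≡ = ∈-tuples⁻ t∈ in
    v , trans x≡ (trans (cong encode t≡) (encode-Tuple v))

  family-unique : Unique family
  family-unique = Unique-map⁺ encode-injective (deduplicate-! _ _)
    where
    encode-injective : ∀ {t u} → t ∈ tuples → u ∈ tuples → encode t ≡ encode u → t ≡ u
    encode-injective t∈ u∈ eq with v , refl ← ∈-tuples⁻ t∈ | w , refl ← ∈-tuples⁻ u∈ =
      ballVector-determines-Tuple (trans (sym (encode-Tuple v)) (trans eq (encode-Tuple w)))

  shattered⇒KMinorModel : ∀ {m} → Shatters family m → KMinorModel ∣ m ∣ G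
  shattered⇒KMinorModel {m} sh = ballsShattered⇒KMinorModel realise
    where
    balls : Vec (Fin k × Fin D) ∣ m ∣
    balls = restrict m tests
    center : Fin ∣ m ∣ → Fin n
    center j = s (proj₁ (lookup balls j))
    radius : Fin ∣ m ∣ → ℕ
    radius j = toℕ (proj₂ (lookup balls j))
    realise : BallsShattered center radius
    realise P with sh (tabulate P)
    ... | x , x∈ , x↾m≡P with ∈-family⁻ x∈
    ...   | v , refl = v , λ j → begin
      passes v (lookup balls j)            ≡⟨ lookup-map j (passes v) balls ⟨
      lookup (map (passes v) balls) j      ≡⟨ cong (λ y → lookup y j) (restrict-map (passes v) m tests) ⟨
      lookup (restrict m (ballVector v)) j ≡⟨ cong (λ y → lookup y j) x↾m≡P ⟩
      lookup (tabulate P) j                ≡⟨ lookup∘tabulate P j ⟩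
      P j                                  ∎
      where open ≡-Reasoning

  family-shattersNoSetOfSize : ∀ {h} → KMinorFree h G → ShattersNoSetOfSize h family
  family-shattersNoSetOfSize free m refl sh = free (shattered⇒KMinorModel {m} sh)

[1+kD]^e≤ : ∀ k D e → suc (k * D) ^ e ≤ 2 ^ e * (k ^ e * D ^ suc e) + 2 ^ e
[1+kD]^e≤ zero    D       e = ≤-trans (≤-reflexive (^-zeroˡ e)) (≤-trans (m^n>0 2 e) (m≤n+m _ _))
[1+kD]^e≤ (suc k) zero    e rewrite *-zeroʳ k =
  ≤-trans (≤-reflexive (^-zeroˡ e)) (≤-trans (m^n>0 2 e) (m≤n+m _ _))
[1+kD]^e≤ k@(suc _) D@(suc _) e = begin
  suc (k * D) ^ e                     ≤⟨ ^-monoˡ-≤ e 1+kD≤2kD ⟩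
  (2 * (k * D)) ^ e                   ≡⟨ ^-distribʳ-* 2 (k * D) e ⟩
  2 ^ e * (k * D) ^ e                 ≡⟨ cong (2 ^ e *_) (^-distribʳ-* k D e) ⟩
  2 ^ e * (k ^ e * D ^ e)             ≤⟨ *-monoʳ-≤ (2 ^ e) (*-monoʳ-≤ (k ^ e) (m≤n*m (D ^ e) D)) ⟩
  2 ^ e * (k ^ e * D ^ suc e)         ≤⟨ m≤m+n _ _ ⟩
  2 ^ e * (k ^ e * D ^ suc e) + 2 ^ e ∎
  where
  open ≤-Reasoning
  1+kD≤2kD : suc (k * D) ≤ 2 * (k * D)
  1+kD≤2kD = subst (suc (k * D) ≤_) (*-comm (k * D) 2) (m<m*n (k * D) 2 (s≤s (s≤s z≤n)))

lemma3p4 : (h : ℕ) → 1 ≤ h →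
    Σ ℕ λ C →
      ∀ (n : ℕ) (G : Graph n) (D : ℕ) →
      KMinorFree h G →
      DiameterAtMost G D →
      (dist : Fin n → Fin n → ℕ) → (∀ u v → IsDist G u v (dist u v)) →
      (k : ℕ) (s : Fin k → Fin n) → Injective _≡_ _≡_ s →
      numTuples dist s ≤ C * (k ^ (h ∸ 1) * D ^ h) + C
-- The sites need not be distinct.
lemma3p4 (suc e) _ = 2 ^ e , λ n G D free diam dist isDist k s _ →
  let open TupleFamily diam isDist s in begin
    numTuples dist s                    ≡⟨ length-map encode tuples ⟨
    length family                       ≤⟨ sauer-shelah (k * D) (suc e) family-unique (family-shattersNoSetOfSize free) ⟩
    Φ (k * D) (suc e)                   ≤⟨ Φ≤[1+N]^e (k * D) e ⟩
    suc (k * D) ^ e                     ≤⟨ [1+kD]^e≤ k D e ⟩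
    2 ^ e * (k ^ e * D ^ suc e) + 2 ^ e ∎
  where open ≤-Reasoning
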